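{- If $G$ and $H$ are graphs such that $H$ has a universal vertex, then $\gamma(G\diamond H)=\gamma(G)$.
   Context: All graphs are finite, simple and undirected. A universal vertex is a vertex adjacent to all other vertices. The modular product $G\diamond H$ has vertex set $V(G)\times V(H)$, and two distinct vertices $(g,h)$ and $(g',h')$ are adjacent iff either ($g=g'$ and $hh'\in E(H)$), or ($gg'\in E(G)$ and $h=h'$), or ($gg'\in E(G)$ and $hh'\in E(H)$), or ($g\neq g'$, $h\neq h'$, $gg'\notin E(G)$ and $hh'\notin E(H)$). $\gamma$ is the domination number. -}

module Defs where

open import Level using (0ℓ)
open import Data.Nat using (ℕ; _≤_)
open import Data.Product using (Σ; _×_; _,_; ∃)
open import Data.Sum using (_⊎_)
open import Data.List using (List; length)
open import Data.List.Membership.Propositional using (_∈_)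
open import Data.List.Relation.Unary.Unique.Propositional using (Unique)
open import Relation.Nullary using (¬_; Dec)
open import Relation.Binary.PropositionalEquality using (_≡_; _≢_)
open import Relation.Binary.Definitions using (DecidableEquality)

record Graph : Set₁ where
  field
    V        : Set
    _~_      : V → V → Set
    ~-sym    : ∀ {u v} → u ~ v → v ~ u
    ~-irrefl : ∀ {v} → ¬ (v ~ v)
    ~-dec    : ∀ u v → Dec (u ~ v)
    _≟V_     : DecidableEquality V
    vertices : List V
    complete : ∀ v → v ∈ vertices

open Graph public

IsUniversal : (H : Graph) → V H → Set
IsUniversal H h = ∀ h' → h' ≢ h → _~_ H h h'

HasUniversalVertex : Graph → Set
HasUniversalVertex H = Σ (V H) (IsUniversal H)

Dominates : {V : Set} → (V → V → Set) → List V → Set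
Dominates {V} _~_ D = ∀ v → v ∈ D ⊎ Σ V (λ u → u ∈ D × u ~ v)

IsDominationNumber : {V : Set} → (V → V → Set) → ℕ → Set
IsDominationNumber {V} _~_ k =
  Σ (List V) (λ D → Unique D × Dominates _~_ D × length D ≡ k)
  × (∀ D → Unique D → Dominates _~_ D → k ≤ length D)

γ[_]≡_ : Graph → ℕ → Set
γ[ G ]≡ k = IsDominationNumber (_~_ G) k

ModAdj : (G H : Graph) → V G × V H → V G × V H → Set
ModAdj G H (g , h) (g' , h') =
    (g ≡ g' × _~_ H h h')
  ⊎ (_~_ G g g' × h ≡ h')
  ⊎ (_~_ G g g' × _~_ H h h')
  ⊎ (g ≢ g' × h ≢ h' × ¬ (_~_ G g g') × ¬ (_~_ H h h'))

γ[_⋄_]≡_ : Graph → Graph → ℕ → Set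
γ[ G ⋄ H ]≡ k = IsDominationNumber (ModAdj G H) k

{-# OPTIONS --safe #-}
module Submission where

-- If u is universal in H, the layer G × {u} of G ⋄ H behaves like G for domination:
-- if d dominates g in G then (d , u) dominates every (g , h), and conversely every
-- closed neighbour of (g , u) has first coordinate in the closed neighbourhood of g,
-- because a vertex (g' , h') with h' ≠ u is adjacent to u in H and so cannot be a
-- neighbour of (g , u) through the "non-adjacent in both factors" clause. Hence
-- dominating sets move back and forth between G and G ⋄ H without growing.

open import Defs
open import Data.Nat using (ℕ; _≤_)
open import Data.Nat.Properties using (≤-trans; ≤-antisym; ≤-reflexive)
open import Data.Empty using (⊥-elim)
open import Data.Product using (Σ; _×_; _,_; proj₁)
open import Data.Product.Properties using (≡-dec)
open import Data.Sum using (inj₁; inj₂)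
open import Data.List using (List; length; map; deduplicate)
open import Data.List.Properties using (length-map; length-deduplicate)
open import Data.List.Membership.Propositional using (_∈_)
open import Data.List.Membership.Propositional.Properties using (∈-map⁺; ∈-deduplicate⁺)
open import Data.List.Relation.Unary.Unique.Propositional using (Unique)
open import Data.List.Relation.Unary.Unique.DecPropositional.Properties using (deduplicate-!)
open import Function.Bundles using (_⇔_; mk⇔)
open import Relation.Binary.Construct.Closure.Reflexive using (ReflClosure; refl; [_])
open import Relation.Binary.Definitions using (DecidableEquality)
open import Relation.Binary.PropositionalEquality using (refl)
open import Relation.Nullary using (yes; no)

DominatingSetsTransfer : {A B : Set} → (A → A → Set) → (B → B → Set) → Set
DominatingSetsTransfer {B = B} _~₁_ _~₂_ = ∀ D → Dominates _~₁_ D →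
  Σ (List B) λ E → Unique E × Dominates _~₂_ E × length E ≤ length D

module _ {A : Set} {_~_ : A → A → Set} {D : List A} where

  dominator : Dominates _~_ D → ∀ v → Σ A λ u → u ∈ D × ReflClosure _~_ u v
  dominator dom v with dom v
  ... | inj₁ v∈D             = v , v∈D , refl
  ... | inj₂ (u , u∈D , u~v) = u , u∈D , [ u~v ]

  dominates : (∀ v → Σ A λ u → u ∈ D × ReflClosure _~_ u v) → Dominates _~_ D
  dominates dom v with dom v
  ... | .v , v∈D , refl   = inj₁ v∈D
  ... | u , u∈D , [ u~v ] = inj₂ (u , u∈D , u~v)

module _ {A B : Set} {_~₁_ : A → A → Set} {_~₂_ : B → B → Set} where

  Dominates-image : (f : A → B) →
    (∀ b → Σ A λ a → ∀ {d} → ReflClosure _~₁_ d a → ReflClosure _~₂_ (f d) b) →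
    ∀ {D E} → Dominates _~₁_ D → (∀ {d} → d ∈ D → f d ∈ E) → Dominates _~₂_ E
  Dominates-image f pull {D} domD f[D]⊆E = dominates λ b →
    let a , pullNeighbours = pull b
        d , d∈D , d≤a      = dominator domD a
    in f d , f[D]⊆E d∈D , pullNeighbours d≤a

  transfer-by-image : DecidableEquality B → (f : A → B) →
    (∀ b → Σ A λ a → ∀ {d} → ReflClosure _~₁_ d a → ReflClosure _~₂_ (f d) b) →
    DominatingSetsTransfer _~₁_ _~₂_
  transfer-by-image _≟_ f pull D domD =
      deduplicate _≟_ (map f D)
    , deduplicate-! _≟_ (map f D)
    , Dominates-image f pull domD (λ d∈D → ∈-deduplicate⁺ _≟_ (∈-map⁺ f d∈D))
    , ≤-trans (length-deduplicate _≟_ (map f D)) (≤-reflexive (length-map f D))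

IsDominationNumber-transfer :
  {A B : Set} {_~₁_ : A → A → Set} {_~₂_ : B → B → Set} {k : ℕ} →
  DominatingSetsTransfer _~₁_ _~₂_ → DominatingSetsTransfer _~₂_ _~₁_ →
  IsDominationNumber _~₁_ k → IsDominationNumber _~₂_ k
IsDominationNumber-transfer {_~₂_ = _~₂_} {k} there back ((D , _ , domD , |D|≡k) , minimal)
  with there D domD
... | E , uniqueE , domE , |E|≤|D| =
  (E , uniqueE , domE , ≤-antisym |E|≤k (k≤ E uniqueE domE)) , k≤
  where
  |E|≤k : length E ≤ k
  |E|≤k = ≤-trans |E|≤|D| (≤-reflexive |D|≡k)

  k≤ : ∀ F → Unique F → Dominates _~₂_ F → k ≤ length F
  k≤ F _ domF =
    let F′ , uniqueF′ , domF′ , |F′|≤|F| = back F domF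
    in ≤-trans (minimal F′ uniqueF′ domF′) |F′|≤|F|

module _ (G H : Graph) {u : V H} (universal : IsUniversal H u) where

  universal-layer-dominates : ∀ {d g h} → ReflClosure (_~_ G) d g →
    ReflClosure (ModAdj G H) (d , u) (g , h)
  universal-layer-dominates {h = h} d≤g with _≟V_ H h u | d≤g
  ... | yes refl | refl    = refl
  ... | yes refl | [ d~g ] = [ inj₂ (inj₁ (d~g , refl)) ]
  ... | no h≢u   | refl    = [ inj₁ (refl , universal h h≢u) ]
  ... | no h≢u   | [ d~g ] = [ inj₂ (inj₂ (inj₁ (d~g , universal h h≢u))) ]

  universal-layer-dominated : ∀ {s g} → ReflClosure (ModAdj G H) s (g , u) →
    ReflClosure (_~_ G) (proj₁ s) g
  universal-layer-dominated refl                                       = refl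
  universal-layer-dominated [ inj₁ (refl , _) ]                        = refl
  universal-layer-dominated [ inj₂ (inj₁ (s~g , _)) ]                  = [ s~g ]
  universal-layer-dominated [ inj₂ (inj₂ (inj₁ (s~g , _))) ]           = [ s~g ]
  universal-layer-dominated {_ , h} [ inj₂ (inj₂ (inj₂ (_ , h≢u , _ , h≁u))) ] =
    ⊥-elim (h≁u (~-sym H (universal h h≢u)))

corollary12 : (G H : Graph) → HasUniversalVertex H
    → ∀ (k : ℕ) → γ[ G ⋄ H ]≡ k ⇔ γ[ G ]≡ k
corollary12 G H (u , universal) k =
  mk⇔ (IsDominationNumber-transfer project lift) (IsDominationNumber-transfer lift project)
  where
  lift : DominatingSetsTransfer (_~_ G) (ModAdj G H)
  lift = transfer-by-image (≡-dec (_≟V_ G) (_≟V_ H)) (_, u)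
    λ (g , _) → g , universal-layer-dominates G H universal

  project : DominatingSetsTransfer (ModAdj G H) (_~_ G)
  project = transfer-by-image (_≟V_ G) proj₁
    λ g → (g , u) , universal-layer-dominated G H universal
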